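{- Let $n,p$ be positive integers and $k$ an integer with $0\le k\le n$. If $(-1)^{n-k}a_{n-k}$ is the coefficient of $x^k$ in the characteristic polynomial $\det(xI_n-F_{n,p})$ of the matrix $F_{n,p}$, then $a_{n-k}$ is the number of compositions of $n+kp-2k$ in which exactly $k$ parts are equal to $p-1$ and all other parts are $\geq p$.
   Context: For positive integers $n,p$, $F_{n,p}$ is the $n\times n$ matrix with entries $F_{n,p}(i,j)=-1$ if $i=j+1$, $F_{n,p}(i,j)=1$ if $j-i\geq p-1$, and $F_{n,p}(i,j)=0$ otherwise. When $p=1$, "compositions" means weak compositions (parts equal to $0$ allowed). -}

module Defs where

open import Data.Nat as ℕ using (ℕ; zero; suc)
open import Data.Integer as ℤ using (ℤ; +_; -_; _+_; _*_)
open import Data.Fin as Fin using (Fin; zero; suc; toℕ; punchIn)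
open import Data.List as List using (List; []; _∷_; length)
open import Data.Nat.ListAction using (sum)
open import Data.List.Relation.Unary.All using (All)
open import Data.List.Relation.Unary.Unique.Propositional using (Unique)
open import Data.List.Membership.Propositional using (_∈_)
open import Data.Product using (Σ; _×_)
open import Relation.Nullary using (Dec; yes; no; ¬_)
open import Relation.Nullary.Decidable using (⌊_⌋)
open import Relation.Binary.PropositionalEquality using (_≡_)
open import Function.Bundles using (_⇔_)
open import Data.Bool using (Bool; true; false; if_then_else_)

-- Polynomials over ℤ as coefficient lists, lowest degree first.

Poly : Set
Poly = List ℤ

_+ₚ_ : Poly → Poly → Poly
[] +ₚ q = q
(a ∷ p) +ₚ [] = a ∷ p
(a ∷ p) +ₚ (b ∷ q) = (a + b) ∷ (p +ₚ q)

scaleₚ : ℤ → Poly → Poly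
scaleₚ c = List.map (c *_)

_*ₚ_ : Poly → Poly → Poly
[] *ₚ q = []
(a ∷ p) *ₚ q = scaleₚ a q +ₚ (+ 0 ∷ (p *ₚ q))

coeff : Poly → ℕ → ℤ
coeff [] k = + 0
coeff (a ∷ p) zero = a
coeff (a ∷ p) (suc k) = coeff p k

sumFin : ∀ {n} → (Fin n → Poly) → Poly
sumFin {zero} f = []
sumFin {suc n} f = f zero +ₚ sumFin (λ j → f (suc j))

sgn : ℕ → ℤ
sgn zero = + 1
sgn (suc m) = - sgn m

det : ∀ {n} → (Fin n → Fin n → Poly) → Poly
det {zero} M = + 1 ∷ []
det {suc n} M =
  sumFin (λ j → scaleₚ (sgn (toℕ j))
                  (M zero j *ₚ det (λ i l → M (suc i) (punchIn j l))))

-- The matrix F_{n,p} (entries indexed from 0; only differences matter).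
-- F(i,j) = -1 if i = j+1, 1 if j - i ≥ p - 1, 0 otherwise.

F : (n p : ℕ) → Fin n → Fin n → ℤ
F n p i j =
  if ⌊ toℕ i ℕ.≟ suc (toℕ j) ⌋ then - (+ 1)
  else if ⌊ toℕ i ℕ.+ (p ℕ.∸ 1) ℕ.≤? toℕ j ⌋ then + 1
  else + 0

xI-minus : ∀ {n} → (Fin n → Fin n → ℤ) → Fin n → Fin n → Poly
xI-minus A i j =
  if ⌊ i Fin.≟ j ⌋ then (- A i j) ∷ + 1 ∷ [] else (- A i j) ∷ []

charPoly : ∀ {n} → (Fin n → Fin n → ℤ) → Poly
charPoly A = det (xI-minus A)

-- Compositions of m (lists of naturals summing to m; parts may be 0,
-- but when p = 1 parts equal to 0 are allowed and otherwise all parts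
-- are ≥ p - 1 anyway) with exactly k parts equal to p-1 and all other
-- parts ≥ p.

count : (ℕ → Bool) → List ℕ → ℕ
count P [] = 0
count P (x ∷ xs) = if P x then suc (count P xs) else count P xs

IsSpecialComposition : (m k p : ℕ) → List ℕ → Set
IsSpecialComposition m k p c =
  sum c ≡ m
  × count (λ x → ⌊ x ℕ.≟ p ℕ.∸ 1 ⌋) c ≡ k
  × All (λ x → ¬ (x ≡ p ℕ.∸ 1) → p ℕ.≤ x) c

-- "the number of elements of the set {c | P c} is N":
-- there is a duplicate-free list enumerating exactly the c with P c,
-- and it has length N.
HasCardinality : {A : Set} → (A → Set) → ℕ → Set
HasCardinality {A} P N =
  Σ (List A) λ L → Unique L × (∀ c → (c ∈ L) ⇔ P c) × length L ≡ N

module Submission where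

-- Write p = q + 1.  The matrix M = x·I − F_{n,p} is upper
-- Hessenberg with every subdiagonal entry equal to 1, and it is Toeplitz:
-- M(i,j) depends only on j − i, with first row M(0,j) = δ_{0j}·x − [q ≤ j].
-- Expanding det M along the first row, the minor of the entry (0,j) begins
-- with j unit columns and then is the same Toeplitz matrix of size n−1−j, so
-- D_n = det(x·I − F_{n,p}) satisfies the Hessenberg recurrence
--   D_{n+1} = Σ_{j≤n} (−1)^j M(0,j) D_{n−j}.
-- On the other side, classifying the compositions of r + kq with exactly k
-- parts equal to q (all other parts > q) by their first part gives the
-- matching recurrence for their number Q(r,k).  Comparing coefficients, an
-- induction on n shows [x^k] D_n = (−1)^{n−k} Q(n−k, k) for k ≤ n (and 0 for
-- k > n); since n + kp − 2k = (n−k) + kq this is the theorem.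

open import Defs
open import Data.Nat using (ℕ; zero; suc; _+_; _*_; _∸_; _≤_; _<_; s≤s; z≤n; NonZero; >-nonZero; _≟_; _≤?_)
import Data.Nat.Properties as ℕP
open import Algebra.Properties.CommutativeSemigroup ℕP.+-commutativeSemigroup using () renaming (x∙yz≈y∙xz to +-exchange)
open import Data.Nat.ListAction using (sum)
open import Data.Nat.Induction using (<-rec)
open import Data.Integer using (ℤ; +_; -_) renaming (_+_ to _+ℤ_; _*_ to _*ℤ_)
import Data.Integer
import Data.Integer.Properties as ℤP
open import Data.Fin as Fin using (Fin; zero; suc; toℕ; punchIn)
import Data.Fin.Properties as FinP
open import Data.List using (List; []; _∷_; _++_; map; length)
import Data.List.Properties as ListP
open import Data.List.Membership.Propositional using (_∈_)
open import Data.List.Membership.Propositional.Properties using (∈-++⁻; ∈-++⁺ˡ; ∈-++⁺ʳ; ∈-map⁻; ∈-map⁺)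
open import Data.List.Relation.Unary.Any using (here)
open import Data.List.Relation.Unary.All using ([]; _∷_)
open import Data.List.Relation.Unary.Unique.Propositional using (Unique)
import Data.List.Relation.Unary.Unique.Propositional.Properties as UniqueP
open import Data.List.Relation.Unary.AllPairs using ([]; _∷_)
open import Data.Bool using (true; false; if_then_else_)
open import Data.Product using (Σ; _×_; _,_; proj₁; proj₂)
open import Data.Sum using (inj₁; inj₂)
open import Data.Empty using (⊥; ⊥-elim)
open import Function.Bundles using (mk⇔)
open import Relation.Nullary using (Dec; yes; no; ¬_)
open import Relation.Nullary.Decidable using (⌊_⌋)
open import Relation.Binary.Bundles using (Setoid)
open import Relation.Binary.Structures using (IsEquivalence)
open import Relation.Binary.PropositionalEquality using (_≡_; refl; sym; trans; cong; cong₂; subst; module ≡-Reasoning)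
import Relation.Binary.Reasoning.Setoid as SetoidReasoning
import Data.Nat.Solver as ℕSolver
import Data.Integer.Solver as ℤSolver

-- Coefficientwise equality of polynomials.  Coefficient lists may carry
-- trailing zeros, so determinants are only determined up to this relation.

infix 4 _≈_
record _≈_ (p q : Poly) : Set where
  constructor coeffwise
  field coeff-≡ : ∀ k → coeff p k ≡ coeff q k
open _≈_

≈-isEquivalence : IsEquivalence _≈_
≈-isEquivalence = record
  { refl  = coeffwise λ _ → refl
  ; sym   = λ e → coeffwise λ k → sym (coeff-≡ e k)
  ; trans = λ e e′ → coeffwise λ k → trans (coeff-≡ e k) (coeff-≡ e′ k)
  }

≈-setoid : Setoid _ _
≈-setoid = record { isEquivalence = ≈-isEquivalence }

open IsEquivalence ≈-isEquivalence using ()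
  renaming (refl to ≈-refl; trans to ≈-trans; reflexive to ≈-reflexive)

module ≈-Reasoning = SetoidReasoning ≈-setoid

1ₚ : Poly
1ₚ = + 1 ∷ []

coeff-+ₚ : ∀ p q k → coeff (p +ₚ q) k ≡ coeff p k +ℤ coeff q k
coeff-+ₚ []      q       k       = sym (ℤP.+-identityˡ _)
coeff-+ₚ (a ∷ p) []      k       = sym (ℤP.+-identityʳ _)
coeff-+ₚ (a ∷ p) (b ∷ q) zero    = refl
coeff-+ₚ (a ∷ p) (b ∷ q) (suc k) = coeff-+ₚ p q k

coeff-scaleₚ : ∀ c p k → coeff (scaleₚ c p) k ≡ c *ℤ coeff p k
coeff-scaleₚ c []      k       = sym (ℤP.*-zeroʳ c)
coeff-scaleₚ c (a ∷ p) zero    = refl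
coeff-scaleₚ c (a ∷ p) (suc k) = coeff-scaleₚ c p k

coeff-*ₚ-zero : ∀ a p q → coeff ((a ∷ p) *ₚ q) 0 ≡ a *ℤ coeff q 0
coeff-*ₚ-zero a p q = trans (coeff-+ₚ (scaleₚ a q) _ 0)
  (trans (ℤP.+-identityʳ _) (coeff-scaleₚ a q 0))

coeff-*ₚ-suc : ∀ a p q k →
  coeff ((a ∷ p) *ₚ q) (suc k) ≡ a *ℤ coeff q (suc k) +ℤ coeff (p *ₚ q) k
coeff-*ₚ-suc a p q k = trans (coeff-+ₚ (scaleₚ a q) _ (suc k))
  (cong (_+ℤ coeff (p *ₚ q) k) (coeff-scaleₚ a q (suc k)))

coeff-constant-*ₚ : ∀ a q k → coeff ((a ∷ []) *ₚ q) k ≡ a *ℤ coeff q k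
coeff-constant-*ₚ a q zero    = coeff-*ₚ-zero a [] q
coeff-constant-*ₚ a q (suc k) = trans (coeff-*ₚ-suc a [] q k) (ℤP.+-identityʳ _)

coeff-*ₚ-identityˡ : ∀ q k → coeff (1ₚ *ₚ q) k ≡ coeff q k
coeff-*ₚ-identityˡ q k = trans (coeff-constant-*ₚ (+ 1) q k) (ℤP.*-identityˡ _)

coeff-linear-*ₚ : ∀ a q k →
  coeff ((a ∷ + 1 ∷ []) *ₚ q) (suc k) ≡ a *ℤ coeff q (suc k) +ℤ coeff q k
coeff-linear-*ₚ a q k = trans (coeff-*ₚ-suc a 1ₚ q k)
  (cong (a *ℤ coeff q (suc k) +ℤ_) (coeff-*ₚ-identityˡ q k))

+ₚ-cong : ∀ {p p′ q q′} → p ≈ p′ → q ≈ q′ → p +ₚ q ≈ p′ +ₚ q′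
+ₚ-cong {p} {p′} {q} {q′} e e′ = coeffwise λ k → begin
  coeff (p +ₚ q) k            ≡⟨ coeff-+ₚ p q k ⟩
  coeff p k +ℤ coeff q k      ≡⟨ cong₂ _+ℤ_ (coeff-≡ e k) (coeff-≡ e′ k) ⟩
  coeff p′ k +ℤ coeff q′ k    ≡⟨ coeff-+ₚ p′ q′ k ⟨
  coeff (p′ +ₚ q′) k          ∎
  where open ≡-Reasoning

+ₚ-identityʳ : ∀ p → p +ₚ [] ≡ p
+ₚ-identityʳ []      = refl
+ₚ-identityʳ (a ∷ p) = refl

scaleₚ-congʳ : ∀ c {q q′} → q ≈ q′ → scaleₚ c q ≈ scaleₚ c q′
scaleₚ-congʳ c {q} {q′} e = coeffwise λ k →
  trans (coeff-scaleₚ c q k) (trans (cong (c *ℤ_) (coeff-≡ e k)) (sym (coeff-scaleₚ c q′ k)))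

scaleₚ-identity : ∀ q → scaleₚ (+ 1) q ≈ q
scaleₚ-identity q = coeffwise λ k → trans (coeff-scaleₚ (+ 1) q k) (ℤP.*-identityˡ _)

scaleₚ-zeroʳ : ∀ c {q} → q ≈ [] → scaleₚ c q ≈ []
scaleₚ-zeroʳ c e = ≈-trans (scaleₚ-congʳ c e) ≈-refl

∷-cong : ∀ a {p q} → p ≈ q → a ∷ p ≈ a ∷ q
∷-cong a e = coeffwise λ { zero → refl ; (suc k) → coeff-≡ e k }

*ₚ-congˡ : ∀ p {q q′} → q ≈ q′ → p *ₚ q ≈ p *ₚ q′
*ₚ-congˡ []      e = ≈-refl
*ₚ-congˡ (a ∷ p) e = +ₚ-cong (scaleₚ-congʳ a e) (∷-cong (+ 0) (*ₚ-congˡ p e))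

*ₚ-zeroʳ : ∀ p {q} → q ≈ [] → p *ₚ q ≈ []
*ₚ-zeroʳ p e = ≈-trans (*ₚ-congˡ p e) (coeffwise (times-nil p))
  where
  times-nil : ∀ p k → coeff (p *ₚ []) k ≡ + 0
  times-nil []      k       = refl
  times-nil (a ∷ p) zero    = refl
  times-nil (a ∷ p) (suc k) = times-nil p k

*ₚ-zeroˡ : ∀ {p} q → p ≈ [] → p *ₚ q ≈ []
*ₚ-zeroˡ {[]}    q e = ≈-refl
*ₚ-zeroˡ {a ∷ p} q e = coeffwise λ
  { zero    → trans (coeff-*ₚ-zero a p q) (a≡0 (coeff q 0))
  ; (suc k) → trans (coeff-*ₚ-suc a p q k)
                (cong₂ _+ℤ_ (a≡0 (coeff q (suc k))) (coeff-≡ (*ₚ-zeroˡ q p≈[]) k))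
  }
  where
  a≡0 : ∀ b → a *ℤ b ≡ + 0
  a≡0 b = trans (cong (_*ℤ b) (coeff-≡ e 0)) (ℤP.*-zeroˡ b)
  p≈[] : p ≈ []
  p≈[] = coeffwise λ k → coeff-≡ e (suc k)

∑ₚ : ℕ → (ℕ → Poly) → Poly
∑ₚ zero    g = []
∑ₚ (suc n) g = g 0 +ₚ ∑ₚ n (λ j → g (suc j))

∑ : ℕ → (ℕ → ℤ) → ℤ
∑ zero    g = + 0
∑ (suc n) g = g 0 +ℤ ∑ n (λ j → g (suc j))

coeff-∑ₚ : ∀ n g k → coeff (∑ₚ n g) k ≡ ∑ n (λ j → coeff (g j) k)
coeff-∑ₚ zero    g k = refl
coeff-∑ₚ (suc n) g k =
  trans (coeff-+ₚ (g 0) _ k) (cong (coeff (g 0) k +ℤ_) (coeff-∑ₚ n (λ j → g (suc j)) k))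

∑ₚ-cong : ∀ n {g h} → (∀ j → j < n → g j ≈ h j) → ∑ₚ n g ≈ ∑ₚ n h
∑ₚ-cong zero    e = ≈-refl
∑ₚ-cong (suc n) e = +ₚ-cong (e 0 (s≤s z≤n)) (∑ₚ-cong n λ j j<n → e (suc j) (s≤s j<n))

∑ₚ-zero : ∀ n {g} → (∀ j → j < n → g j ≈ []) → ∑ₚ n g ≈ []
∑ₚ-zero zero    e = ≈-refl
∑ₚ-zero (suc n) e = +ₚ-cong (e 0 (s≤s z≤n)) (∑ₚ-zero n λ j j<n → e (suc j) (s≤s j<n))

∑-cong : ∀ n {g h} → (∀ j → j < n → g j ≡ h j) → ∑ n g ≡ ∑ n h
∑-cong zero    e = refl
∑-cong (suc n) e = cong₂ _+ℤ_ (e 0 (s≤s z≤n)) (∑-cong n λ j j<n → e (suc j) (s≤s j<n))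

∑-zero : ∀ n {g} → (∀ j → j < n → g j ≡ + 0) → ∑ n g ≡ + 0
∑-zero zero    e = refl
∑-zero (suc n) e = cong₂ _+ℤ_ (e 0 (s≤s z≤n)) (∑-zero n λ j j<n → e (suc j) (s≤s j<n))

∑-split : ∀ a b g → ∑ (a + b) g ≡ ∑ a g +ℤ ∑ b (λ j → g (a + j))
∑-split zero    b g = sym (ℤP.+-identityˡ _)
∑-split (suc a) b g = trans (cong (g 0 +ℤ_) (∑-split a b (λ j → g (suc j))))
  (sym (ℤP.+-assoc (g 0) _ _))

∑-*ˡ : ∀ n c g → ∑ n (λ j → c *ℤ g j) ≡ c *ℤ ∑ n g
∑-*ˡ zero    c g = sym (ℤP.*-zeroʳ c)
∑-*ˡ (suc n) c g = trans (cong (c *ℤ g 0 +ℤ_) (∑-*ˡ n c (λ j → g (suc j))))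
  (sym (ℤP.*-distribˡ-+ c (g 0) _))

detℕ : ℕ → (ℕ → ℕ → Poly) → Poly
detℕ n M = det {n} (λ i j → M (toℕ i) (toℕ j))

sumFin-cong : ∀ {n} {f g : Fin n → Poly} → (∀ j → f j ≡ g j) → sumFin f ≡ sumFin g
sumFin-cong {zero}  e = refl
sumFin-cong {suc n} e = cong₂ _+ₚ_ (e zero) (sumFin-cong (λ j → e (suc j)))

sumFin-toℕ : ∀ n g → sumFin {n} (λ j → g (toℕ j)) ≡ ∑ₚ n g
sumFin-toℕ zero    g = refl
sumFin-toℕ (suc n) g = cong (g 0 +ₚ_) (sumFin-toℕ n (λ j → g (suc j)))

det-cong : ∀ {n} {M N : Fin n → Fin n → Poly} → (∀ i j → M i j ≡ N i j) → det M ≡ det N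
det-cong {zero}  e = refl
det-cong {suc n} e = sumFin-cong λ j →
  cong₂ (λ a D → scaleₚ (sgn (toℕ j)) (a *ₚ D)) (e zero j)
        (det-cong (λ i l → e (suc i) (punchIn j l)))

detℕ-cong : ∀ n M N → (∀ i j → M i j ≡ N i j) → detℕ n M ≡ detℕ n N
detℕ-cong n M N e = det-cong {n} (λ i j → e (toℕ i) (toℕ j))

punchInℕ : ℕ → ℕ → ℕ
punchInℕ zero    l       = suc l
punchInℕ (suc j) zero    = zero
punchInℕ (suc j) (suc l) = suc (punchInℕ j l)

toℕ-punchIn : ∀ {n} (j : Fin (suc n)) (l : Fin n) → toℕ (punchIn j l) ≡ punchInℕ (toℕ j) (toℕ l)
toℕ-punchIn zero    l       = refl
toℕ-punchIn (suc j) zero    = refl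
toℕ-punchIn (suc j) (suc l) = cong suc (toℕ-punchIn j l)

punchInℕ-below : ∀ {j l} → l < j → punchInℕ j l ≡ l
punchInℕ-below {suc j} {zero}  _         = refl
punchInℕ-below {suc j} {suc l} (s≤s l<j) = cong suc (punchInℕ-below l<j)

punchInℕ-beyond : ∀ j l → punchInℕ j (j + l) ≡ suc (j + l)
punchInℕ-beyond zero    l = refl
punchInℕ-beyond (suc j) l = cong suc (punchInℕ-beyond j l)

minor : ℕ → (ℕ → ℕ → Poly) → ℕ → ℕ → Poly
minor j M i l = M (suc i) (punchInℕ j l)

det-expand : ∀ n M →
  detℕ (suc n) M ≡ ∑ₚ (suc n) (λ j → scaleₚ (sgn j) (M 0 j *ₚ detℕ n (minor j M)))
det-expand n M = trans
  (sumFin-cong λ j → cong (λ D → scaleₚ (sgn (toℕ j)) (M 0 (toℕ j) *ₚ D))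
                          (det-cong {n} λ i l → cong (M (suc (toℕ i))) (toℕ-punchIn j l)))
  (sumFin-toℕ (suc n) λ j → scaleₚ (sgn j) (M 0 j *ₚ detℕ n (minor j M)))

det-firstColumn : ∀ n M → (∀ i → M (suc i) 0 ≈ []) →
  detℕ (suc n) M ≈ M 0 0 *ₚ detℕ n (minor 0 M)
det-zeroColumn : ∀ n M → (∀ i → M i 0 ≈ []) → detℕ (suc n) M ≈ []

det-firstColumn n M zeroBelow = begin
  detℕ (suc n) M
    ≡⟨ det-expand n M ⟩
  scaleₚ (+ 1) (M 0 0 *ₚ detℕ n (minor 0 M)) +ₚ ∑ₚ n (λ j → scaleₚ (sgn (suc j)) (M 0 (suc j) *ₚ detℕ n (minor (suc j) M)))
    ≈⟨ +ₚ-cong (scaleₚ-identity _) (∑ₚ-zero n λ j j<n →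
         scaleₚ-zeroʳ (sgn (suc j)) (*ₚ-zeroʳ (M 0 (suc j)) (other-minors n j<n))) ⟩
  (M 0 0 *ₚ detℕ n (minor 0 M)) +ₚ []
    ≡⟨ +ₚ-identityʳ _ ⟩
  M 0 0 *ₚ detℕ n (minor 0 M) ∎
  where
  open ≈-Reasoning
  -- deleting a column other than the first keeps the vanishing first column
  other-minors : ∀ n {j} → j < n → detℕ n (minor (suc j) M) ≈ []
  other-minors (suc n) {j} _ = det-zeroColumn n (minor (suc j) M) zeroBelow

det-zeroColumn n M zeroCol =
  ≈-trans (det-firstColumn n M (λ i → zeroCol (suc i))) (*ₚ-zeroˡ _ (zeroCol 0))

det-unitColumns : ∀ j n N → j ≤ n →
  (∀ l → l < j → N l l ≡ 1ₚ) → (∀ l i → l < j → l < i → N i l ≈ []) →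
  detℕ n N ≈ detℕ (n ∸ j) (λ i l → N (j + i) (j + l))
det-unitColumns zero    n       N _         _    _     = ≈-refl
det-unitColumns (suc j) (suc n) N (s≤s j≤n) unit below = begin
  detℕ (suc n) N
    ≈⟨ det-firstColumn n N (λ i → below 0 (suc i) (s≤s z≤n) (s≤s z≤n)) ⟩
  N 0 0 *ₚ detℕ n (minor 0 N)
    ≡⟨ cong (_*ₚ detℕ n (minor 0 N)) (unit 0 (s≤s z≤n)) ⟩
  1ₚ *ₚ detℕ n (minor 0 N)
    ≈⟨ coeffwise (coeff-*ₚ-identityˡ (detℕ n (minor 0 N))) ⟩
  detℕ n (minor 0 N)
    ≈⟨ det-unitColumns j n (minor 0 N) j≤n (λ l l<j → unit (suc l) (s≤s l<j))
         (λ l i l<j l<i → below (suc l) (suc i) (s≤s l<j) (s≤s l<i)) ⟩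
  detℕ (n ∸ j) (λ i l → N (suc j + i) (suc j + l)) ∎
  where open ≈-Reasoning

-- If all subdiagonal entries are 1
-- and all entries further below vanish, the minor of the entry (0,j) starts
-- with j unit columns, so only the lower-right block of M survives:
--   det_{n+1} M = Σ_{j≤n} (−1)^j M(0,j) · det_{n−j}(M shifted by j+1).
det-hessenberg : ∀ n M → (∀ l → M (suc l) l ≡ 1ₚ) → (∀ l i → suc l < i → M i l ≈ []) →
  detℕ (suc n) M ≈
    ∑ₚ (suc n) (λ j → scaleₚ (sgn j) (M 0 j *ₚ detℕ (n ∸ j) (λ i l → M (suc j + i) (suc j + l))))
det-hessenberg n M subdiagonal below = ≈-trans (≈-reflexive (det-expand n M))
  (∑ₚ-cong (suc n) λ j j≤n → scaleₚ-congʳ (sgn j) (*ₚ-congˡ (M 0 j) (minor-reduces j (ℕP.≤-pred j≤n))))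
  where
  open ≈-Reasoning
  minor-reduces : ∀ j → j ≤ n →
    detℕ n (minor j M) ≈ detℕ (n ∸ j) (λ i l → M (suc j + i) (suc j + l))
  minor-reduces j j≤n = begin
    detℕ n (minor j M)
      ≈⟨ det-unitColumns j n (minor j M) j≤n
           (λ l l<j → trans (cong (M (suc l)) (punchInℕ-below l<j)) (subdiagonal l))
           (λ l i l<j l<i → subst (λ c → M (suc i) c ≈ []) (sym (punchInℕ-below l<j))
                                  (below l (suc i) (s≤s l<i))) ⟩
    detℕ (n ∸ j) (λ i l → M (suc (j + i)) (punchInℕ j (j + l)))
      ≡⟨ detℕ-cong (n ∸ j) _ _ (λ i l → cong (M (suc (j + i))) (punchInℕ-beyond j l)) ⟩
    detℕ (n ∸ j) (λ i l → M (suc j + i) (suc j + l)) ∎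

⌊⌋-true : ∀ {A : Set} (a? : Dec A) → A → ⌊ a? ⌋ ≡ true
⌊⌋-true (yes _) _ = refl
⌊⌋-true (no ¬a) a = ⊥-elim (¬a a)

⌊⌋-false : ∀ {A : Set} (a? : Dec A) → ¬ A → ⌊ a? ⌋ ≡ false
⌊⌋-false (yes a) ¬a = ⊥-elim (¬a a)
⌊⌋-false (no _)  _  = refl

⌊⌋-agree : ∀ {A B : Set} (a? : Dec A) (b? : Dec B) → (A → B) → (B → A) → ⌊ a? ⌋ ≡ ⌊ b? ⌋
⌊⌋-agree a? (yes b) _ g = ⌊⌋-true a? (g b)
⌊⌋-agree a? (no ¬b) f _ = ⌊⌋-false a? (λ a → ¬b (f a))

-- The indicator [q ≤ j] as an integer; F_{n,q+1}(0,j) = atLeast q j.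
atLeast : ℕ → ℕ → ℤ
atLeast q j = if ⌊ q ≤? j ⌋ then + 1 else + 0

module CharacteristicPolynomial (q : ℕ) where

  Fℕ : ℕ → ℕ → ℤ
  Fℕ i j = if ⌊ i ≟ suc j ⌋ then - (+ 1) else if ⌊ i + q ≤? j ⌋ then + 1 else + 0

  E : ℕ → ℕ → Poly
  E i j = if ⌊ i ≟ j ⌋ then (- Fℕ i j) ∷ + 1 ∷ [] else (- Fℕ i j) ∷ []

  D : ℕ → Poly
  D n = detℕ n E

  d : ℕ → ℕ → ℤ
  d n k = coeff (D n) k

  charPoly≡D : ∀ n → charPoly (F n (suc q)) ≡ D n
  charPoly≡D n = det-cong {n} xI-entry
    where
    xI-entry : (i j : Fin n) → xI-minus (F n (suc q)) i j ≡ E (toℕ i) (toℕ j)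
    xI-entry i j rewrite ⌊⌋-agree (i Fin.≟ j) (toℕ i ≟ toℕ j) (cong toℕ) FinP.toℕ-injective = refl

  E-shift : ∀ i j → E (suc i) (suc j) ≡ E i j
  E-shift i j
    rewrite ⌊⌋-agree (suc i + q ≤? suc j) (i + q ≤? j) ℕP.≤-pred s≤s
          | ⌊⌋-agree (suc i ≟ suc j) (i ≟ j) ℕP.suc-injective (cong suc)
          | ⌊⌋-agree (suc i ≟ suc (suc j)) (i ≟ suc j) ℕP.suc-injective (cong suc) = refl

  E-shiftBy : ∀ m i j → E (m + i) (m + j) ≡ E i j
  E-shiftBy zero    i j = refl
  E-shiftBy (suc m) i j = trans (E-shift (m + i) (m + j)) (E-shiftBy m i j)

  E-subdiagonal : ∀ l → E (suc l) l ≡ 1ₚ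
  E-subdiagonal l
    rewrite ⌊⌋-false (suc l ≟ l) ℕP.1+n≢n
          | ⌊⌋-true (suc l ≟ suc l) refl = refl

  E-belowSubdiagonal : ∀ l i → suc l < i → E i l ≈ []
  E-belowSubdiagonal l (suc i) (s≤s l<i)
    rewrite ⌊⌋-false (suc i ≟ l) (λ e → ℕP.<-irrefl (sym e) (ℕP.<-trans l<i ℕP.≤-refl))
          | ⌊⌋-false (suc i ≟ suc l) (λ e → ℕP.<-irrefl (sym (ℕP.suc-injective e)) l<i)
          | ⌊⌋-false (suc i + q ≤? l) (λ le → ℕP.<-irrefl refl
              (ℕP.<-≤-trans (ℕP.<-trans l<i ℕP.≤-refl) (ℕP.m+n≤o⇒m≤o (suc i) le)))
    = coeffwise λ { zero → refl ; (suc k) → refl }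

  -- The Hessenberg expansion of x·I − F along its first row, where
  -- E 0 0 = −[q ≤ 0] + x and E 0 j = −[q ≤ j] for j > 0.
  rowTerm : ℕ → ℕ → Poly
  rowTerm n j = scaleₚ (sgn j) (E 0 j *ₚ D (n ∸ j))

  D-recurrence : ∀ n → D (suc n) ≈ ∑ₚ (suc n) (rowTerm n)
  D-recurrence n = ≈-trans (det-hessenberg n E E-subdiagonal E-belowSubdiagonal)
    (∑ₚ-cong (suc n) λ j _ → ≈-reflexive (cong (λ P → scaleₚ (sgn j) (E 0 j *ₚ P))
      (detℕ-cong (n ∸ j) _ E (E-shiftBy (suc j)))))

  -- Coefficientwise, apart from the x·D n contributed by E 0 0, the terms are
  -- (−1)^j · (−[q ≤ j]) · d (n − j) k.
  term : ℕ → ℕ → ℕ → ℤ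
  term n k j = sgn j *ℤ (- atLeast q j *ℤ d (n ∸ j) k)

  coeff-rowTerm-suc : ∀ n j k → coeff (rowTerm n (suc j)) k ≡ term n k (suc j)
  coeff-rowTerm-suc n j k = trans (coeff-scaleₚ (sgn (suc j)) (E 0 (suc j) *ₚ D (n ∸ suc j)) k)
    (cong (sgn (suc j) *ℤ_) (coeff-constant-*ₚ (- atLeast q (suc j)) (D (n ∸ suc j)) k))

  coeff-rowTerm-zero : ∀ n → coeff (rowTerm n 0) 0 ≡ term n 0 0
  coeff-rowTerm-zero n = trans (coeff-scaleₚ (+ 1) (E 0 0 *ₚ D n) 0)
    (cong (+ 1 *ℤ_) (coeff-*ₚ-zero (- atLeast q 0) 1ₚ (D n)))

  coeff-rowTerm-x : ∀ n k → coeff (rowTerm n 0) (suc k) ≡ term n (suc k) 0 +ℤ d n k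
  coeff-rowTerm-x n k = begin
    coeff (rowTerm n 0) (suc k)                             ≡⟨ coeff-scaleₚ (+ 1) (E 0 0 *ₚ D n) (suc k) ⟩
    + 1 *ℤ coeff (E 0 0 *ₚ D n) (suc k)                     ≡⟨ ℤP.*-identityˡ (coeff (E 0 0 *ₚ D n) (suc k)) ⟩
    coeff (E 0 0 *ₚ D n) (suc k)                            ≡⟨ coeff-linear-*ₚ (- atLeast q 0) (D n) k ⟩
    - atLeast q 0 *ℤ d n (suc k) +ℤ d n k                   ≡⟨ cong (_+ℤ d n k) (ℤP.*-identityˡ (- atLeast q 0 *ℤ d n (suc k))) ⟨
    term n (suc k) 0 +ℤ d n k                               ∎
    where open ≡-Reasoning

  coeff-D-suc : ∀ n k → d (suc n) k ≡ coeff (rowTerm n 0) k +ℤ ∑ n (λ j → coeff (rowTerm n (suc j)) k)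
  coeff-D-suc n k = trans (coeff-≡ (D-recurrence n) k) (coeff-∑ₚ (suc n) (rowTerm n) k)

  d-recurrence-zero : ∀ n → d (suc n) 0 ≡ ∑ (suc n) (term n 0)
  d-recurrence-zero n = trans (coeff-D-suc n 0)
    (cong₂ _+ℤ_ (coeff-rowTerm-zero n) (∑-cong n λ j _ → coeff-rowTerm-suc n j 0))

  d-recurrence-suc : ∀ n k → d (suc n) (suc k) ≡ d n k +ℤ ∑ (suc n) (term n (suc k))
  d-recurrence-suc n k = begin
    d (suc n) (suc k)
      ≡⟨ coeff-D-suc n (suc k) ⟩
    coeff (rowTerm n 0) (suc k) +ℤ ∑ n (λ j → coeff (rowTerm n (suc j)) (suc k))
      ≡⟨ cong₂ _+ℤ_ (coeff-rowTerm-x n k) (∑-cong n λ j _ → coeff-rowTerm-suc n j (suc k)) ⟩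
    (term n (suc k) 0 +ℤ d n k) +ℤ ∑ n (λ j → term n (suc k) (suc j))
      ≡⟨ cong (_+ℤ ∑ n (λ j → term n (suc k) (suc j))) (ℤP.+-comm (term n (suc k) 0) (d n k)) ⟩
    (d n k +ℤ term n (suc k) 0) +ℤ ∑ n (λ j → term n (suc k) (suc j))
      ≡⟨ ℤP.+-assoc (d n k) (term n (suc k) 0) (∑ n (λ j → term n (suc k) (suc j))) ⟩
    d n k +ℤ ∑ (suc n) (term n (suc k)) ∎
    where open ≡-Reasoning

concatℕ : {A : Set} → ℕ → (ℕ → List A) → List A
concatℕ zero    g = []
concatℕ (suc n) g = g 0 ++ concatℕ n (λ j → g (suc j))

concatℕ-cong : {A : Set} → ∀ n {g h : ℕ → List A} → (∀ j → j < n → g j ≡ h j) →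
  concatℕ n g ≡ concatℕ n h
concatℕ-cong zero    e = refl
concatℕ-cong (suc n) e = cong₂ _++_ (e 0 (s≤s z≤n)) (concatℕ-cong n λ j j<n → e (suc j) (s≤s j<n))

∈-concatℕ⁻ : {A : Set} → ∀ n (g : ℕ → List A) {x} → x ∈ concatℕ n g → Σ ℕ λ j → j < n × x ∈ g j
∈-concatℕ⁻ (suc n) g x∈ with ∈-++⁻ (g 0) x∈
... | inj₁ x∈g0   = 0 , s≤s z≤n , x∈g0
... | inj₂ x∈rest with ∈-concatℕ⁻ n (λ j → g (suc j)) x∈rest
...   | j , j<n , x∈gj = suc j , s≤s j<n , x∈gj

∈-concatℕ⁺ : {A : Set} → ∀ n (g : ℕ → List A) {x} j → j < n → x ∈ g j → x ∈ concatℕ n g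
∈-concatℕ⁺ (suc n) g zero    _         x∈ = ∈-++⁺ˡ x∈
∈-concatℕ⁺ (suc n) g (suc j) (s≤s j<n) x∈ = ∈-++⁺ʳ (g 0) (∈-concatℕ⁺ n (λ j → g (suc j)) j j<n x∈)

concatℕ-unique : {A : Set} → ∀ n (g : ℕ → List A) → (∀ j → Unique (g j)) →
  (∀ i j {x} → x ∈ g i → x ∈ g j → i ≡ j) → Unique (concatℕ n g)
concatℕ-unique zero    g unique disjoint = []
concatℕ-unique (suc n) g unique disjoint = UniqueP.++⁺ (unique 0)
  (concatℕ-unique n (λ j → g (suc j)) (λ j → unique (suc j))
    (λ i j x∈ x∈′ → ℕP.suc-injective (disjoint (suc i) (suc j) x∈ x∈′)))
  λ { (x∈g0 , x∈rest) → let (j , _ , x∈gj) = ∈-concatℕ⁻ n (λ j → g (suc j)) x∈rest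
                        in ℕP.0≢1+n (disjoint 0 (suc j) x∈g0 x∈gj) }

length-concatℕ : {A : Set} → ∀ n (g : ℕ → List A) →
  + length (concatℕ n g) ≡ ∑ n (λ j → + length (g j))
length-concatℕ zero    g = refl
length-concatℕ (suc n) g = begin
  + length (g 0 ++ concatℕ n (λ j → g (suc j)))              ≡⟨ cong +_ (ListP.length-++ (g 0)) ⟩
  + (length (g 0) + length (concatℕ n (λ j → g (suc j))))    ≡⟨ ℤP.pos-+ (length (g 0)) _ ⟩
  + length (g 0) +ℤ + length (concatℕ n (λ j → g (suc j)))   ≡⟨ cong (+ length (g 0) +ℤ_) (length-concatℕ n (λ j → g (suc j))) ⟩
  ∑ (suc n) (λ j → + length (g j))                          ∎
  where open ≡-Reasoning

count-≤-sum : ∀ q c k → count (λ x → ⌊ x ≟ q ⌋) c ≡ k → k * q ≤ sum c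
count-≤-sum q []      k refl = z≤n
count-≤-sum q (x ∷ c) k e with x ≟ q
count-≤-sum q (x ∷ c) k refl | yes refl = ℕP.+-monoʳ-≤ x (count-≤-sum q c _ refl)
count-≤-sum q (x ∷ c) k e    | no _     = ℕP.≤-trans (count-≤-sum q c k e) (ℕP.m≤n+m (sum c) x)

remainder-smaller : ∀ {r j} k → j < r → (r ∸ suc j) + k < r + k
remainder-smaller {r} {j} k j<r = ℕP.+-monoˡ-< k (ℕP.∸-monoʳ-< {r} {suc j} {0} (s≤s z≤n) j<r)

module Compositions (q : ℕ) where

  Special : ℕ → ℕ → List ℕ → Set
  Special r k = IsSpecialComposition (r + k * q) k (suc q)

  -- Enumeration by the first part: the empty composition (r = k = 0), a part
  -- q followed by a composition for (r, k − 1), or a part j + 1 with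
  -- q ≤ j < r followed by a composition for (r − j − 1, k).  The recursion
  -- decreases r + k; the first argument of enum is fuel bounding it.
  startEmpty : ℕ → ℕ → List (List ℕ)
  startEmpty r       (suc k) = []
  startEmpty zero    zero    = [] ∷ []
  startEmpty (suc r) zero    = []

  enum : ℕ → ℕ → ℕ → List (List ℕ)
  startSpecial : ℕ → ℕ → ℕ → List (List ℕ)
  startOrdinary : ℕ → ℕ → ℕ → ℕ → List (List ℕ)

  enum zero    r k = []
  enum (suc f) r k = startEmpty r k ++ (startSpecial f r k ++ concatℕ r (startOrdinary f r k))
  startSpecial f r zero    = []
  startSpecial f r (suc k) = map (q ∷_) (enum f r k)
  startOrdinary f r k j = if ⌊ q ≤? j ⌋ then map (suc j ∷_) (enum f (r ∸ suc j) k) else []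

  enum-fuel : ∀ f f′ r k → r + k < f → r + k < f′ → enum f r k ≡ enum f′ r k
  enum-fuel (suc f) (suc f′) r k (s≤s r+k≤f) (s≤s r+k≤f′) =
    cong (startEmpty r k ++_) (cong₂ _++_ (special k r+k≤f r+k≤f′) (concatℕ-cong r ordinary))
    where
    special : ∀ k → r + k ≤ f → r + k ≤ f′ → startSpecial f r k ≡ startSpecial f′ r k
    special zero    _ _ = refl
    special (suc k) a b = cong (map (q ∷_)) (enum-fuel f f′ r k
      (ℕP.≤-trans (ℕP.≤-reflexive (sym (ℕP.+-suc r k))) a)
      (ℕP.≤-trans (ℕP.≤-reflexive (sym (ℕP.+-suc r k))) b))
    ordinary : ∀ j → j < r → startOrdinary f r k j ≡ startOrdinary f′ r k j
    ordinary j j<r with ⌊ q ≤? j ⌋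
    ... | true  = cong (map (suc j ∷_)) (enum-fuel f f′ (r ∸ suc j) k
                    (ℕP.<-≤-trans (remainder-smaller k j<r) r+k≤f)
                    (ℕP.<-≤-trans (remainder-smaller k j<r) r+k≤f′))
    ... | false = refl

  enum-sound : ∀ f r k c → c ∈ enum f r k → Special r k c
  enum-sound (suc f) r k c c∈ with ∈-++⁻ (startEmpty r k) c∈
  enum-sound (suc f) zero    zero    c c∈ | inj₁ (here refl) = refl , refl , []
  enum-sound (suc f) (suc r) zero    c c∈ | inj₁ ()
  enum-sound (suc f) r       (suc k) c c∈ | inj₁ ()
  enum-sound (suc f) r k c c∈ | inj₂ c∈′ with ∈-++⁻ (startSpecial f r k) c∈′
  enum-sound (suc f) r (suc k) c c∈ | inj₂ c∈′ | inj₁ c∈s with ∈-map⁻ (q ∷_) c∈s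
  ... | c′ , c′∈ , refl with enum-sound f r k c′ c′∈
  ...   | sum≡ , count≡ , parts = sum≡′ , count≡′ , ((λ q≢q → ⊥-elim (q≢q refl)) ∷ parts)
    where
    sum≡′ : q + sum c′ ≡ r + (q + k * q)
    sum≡′ = trans (cong (λ s → q + s) sum≡) (+-exchange q r (k * q))
    count≡′ : count (λ x → ⌊ x ≟ q ⌋) (q ∷ c′) ≡ suc k
    count≡′ rewrite ⌊⌋-true (q ≟ q) refl = cong suc count≡
  enum-sound (suc f) r k c c∈ | inj₂ c∈′ | inj₂ c∈o with ∈-concatℕ⁻ r (startOrdinary f r k) c∈o
  ... | j , j<r , c∈j with q ≤? j
  ...   | no _    = ⊥-elim (∉[] c∈j)
    where
    ∉[] : c ∈ [] → ⊥
    ∉[] ()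
  ...   | yes q≤j with ∈-map⁻ (suc j ∷_) c∈j
  ...     | c′ , c′∈ , refl with enum-sound f (r ∸ suc j) k c′ c′∈
  ...       | sum≡ , count≡ , parts = sum≡′ , count≡′ , ((λ _ → s≤s q≤j) ∷ parts)
    where
    sum≡′ : suc j + sum c′ ≡ r + k * q
    sum≡′ = trans (cong (λ s → suc j + s) sum≡) (trans (sym (ℕP.+-assoc (suc j) (r ∸ suc j) (k * q)))
      (cong (_+ k * q) (ℕP.m+[n∸m]≡n j<r)))
    count≡′ : count (λ x → ⌊ x ≟ q ⌋) (suc j ∷ c′) ≡ k
    count≡′ rewrite ⌊⌋-false (suc j ≟ q) (λ e → ℕP.<-irrefl (sym e) (s≤s q≤j)) = count≡

  enum-complete : ∀ f r k c → r + k < f → Special r k c → c ∈ enum f r k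
  enum-complete (suc f) zero    zero [] _ (_ , refl , _) =
    ∈-++⁺ˡ {ys = startSpecial f 0 0 ++ concatℕ 0 (startOrdinary f 0 0)} (here refl)
  enum-complete (suc f) (suc r) zero [] _ (() , refl , _)
  enum-complete (suc f) r k (x ∷ c) (s≤s r+k≤f) (sum≡ , count≡ , large ∷ parts) with x ≟ q
  enum-complete (suc f) r zero    (x ∷ c) (s≤s r+k≤f) (sum≡ , () , large ∷ parts) | yes refl
  enum-complete (suc f) r (suc k) (x ∷ c) (s≤s r+k≤f) (sum≡ , count≡ , large ∷ parts) | yes refl =
    ∈-++⁺ʳ (startEmpty r (suc k)) (∈-++⁺ˡ (∈-map⁺ (q ∷_) c∈))
    where
    sum≡′ : sum c ≡ r + k * q
    sum≡′ = ℕP.+-cancelˡ-≡ q (sum c) (r + k * q) (trans sum≡ (+-exchange r q (k * q)))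
    c∈ : c ∈ enum f r k
    c∈ = enum-complete f r k c (ℕP.≤-trans (ℕP.≤-reflexive (sym (ℕP.+-suc r k))) r+k≤f)
      (sum≡′ , ℕP.suc-injective count≡ , parts)
  enum-complete (suc f) r k (x ∷ c) (s≤s r+k≤f) (sum≡ , count≡ , large ∷ parts) | no x≢q
    with large x≢q
  ... | s≤s {n = j} q≤j =
    ∈-++⁺ʳ (startEmpty r k) (∈-++⁺ʳ (startSpecial f r k) (∈-concatℕ⁺ r (startOrdinary f r k) j j<r c∈j))
    where
    j<r : j < r
    j<r = ℕP.+-cancelʳ-≤ (k * q) (suc j) r
      (ℕP.≤-trans (ℕP.+-monoʳ-≤ (suc j) (count-≤-sum q c k count≡)) (ℕP.≤-reflexive sum≡))
    sum≡′ : sum c ≡ (r ∸ suc j) + k * q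
    sum≡′ = ℕP.+-cancelˡ-≡ (suc j) (sum c) ((r ∸ suc j) + k * q) (trans sum≡
      (trans (cong (_+ k * q) (sym (ℕP.m+[n∸m]≡n j<r))) (ℕP.+-assoc (suc j) (r ∸ suc j) (k * q))))
    c∈ : c ∈ enum f (r ∸ suc j) k
    c∈ = enum-complete f (r ∸ suc j) k c (ℕP.<-≤-trans (remainder-smaller k j<r) r+k≤f)
      (sum≡′ , count≡ , parts)
    c∈j : suc j ∷ c ∈ startOrdinary f r k j
    c∈j with q ≤? j
    ... | yes _   = ∈-map⁺ (suc j ∷_) c∈
    ... | no q≰j = ⊥-elim (q≰j q≤j)

  startEmpty-nil : ∀ r k {c} → c ∈ startEmpty r k → c ≡ []
  startEmpty-nil zero zero (here e) = e

  startSpecial-head : ∀ f r k {c} → c ∈ startSpecial f r k → Σ (List ℕ) λ c′ → c ≡ q ∷ c′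
  startSpecial-head f r (suc k) c∈ with ∈-map⁻ (q ∷_) c∈
  ... | c′ , _ , e = c′ , e

  startOrdinary-head : ∀ f r k j {c} → c ∈ startOrdinary f r k j →
    Σ (List ℕ) λ c′ → c ≡ suc j ∷ c′ × q ≤ j
  startOrdinary-head f r k j c∈ with q ≤? j
  startOrdinary-head f r k j c∈ | yes q≤j with ∈-map⁻ (suc j ∷_) c∈
  ... | c′ , _ , e = c′ , e , q≤j
  startOrdinary-head f r k j () | no _

  enum-unique : ∀ f r k → Unique (enum f r k)
  enum-unique zero    r k = []
  enum-unique (suc f) r k =
    UniqueP.++⁺ (empty-unique r k) (UniqueP.++⁺ (special-unique k) ordinary-unique special∩ordinary) empty∩rest
    where
    empty-unique : ∀ r k → Unique (startEmpty r k)
    empty-unique r       (suc k) = []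
    empty-unique zero    zero    = [] ∷ []
    empty-unique (suc r) zero    = []
    special-unique : ∀ k → Unique (startSpecial f r k)
    special-unique zero    = []
    special-unique (suc k) = UniqueP.map⁺ ListP.∷-injectiveʳ (enum-unique f r k)
    ordinary-unique : Unique (concatℕ r (startOrdinary f r k))
    ordinary-unique = concatℕ-unique r (startOrdinary f r k) each λ i j c∈i c∈j →
      let (_ , ei , _) = startOrdinary-head f r k i c∈i
          (_ , ej , _) = startOrdinary-head f r k j c∈j
      in ℕP.suc-injective (ListP.∷-injectiveˡ (trans (sym ei) ej))
      where
      each : ∀ j → Unique (startOrdinary f r k j)
      each j with ⌊ q ≤? j ⌋
      ... | true  = UniqueP.map⁺ ListP.∷-injectiveʳ (enum-unique f (r ∸ suc j) k)
      ... | false = []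
    special∩ordinary : ∀ {c} → ¬ (c ∈ startSpecial f r k × c ∈ concatℕ r (startOrdinary f r k))
    special∩ordinary (c∈s , c∈o) with ∈-concatℕ⁻ r (startOrdinary f r k) c∈o
    ... | j , _ , c∈j with startSpecial-head f r k c∈s | startOrdinary-head f r k j c∈j
    ...   | _ , es | _ , eo , q≤j = ℕP.<-irrefl (ListP.∷-injectiveˡ (trans (sym es) eo)) (s≤s q≤j)
    empty∩rest : ∀ {c} → ¬ (c ∈ startEmpty r k × c ∈ (startSpecial f r k ++ concatℕ r (startOrdinary f r k)))
    empty∩rest (c∈e , c∈rest) with startEmpty-nil r k c∈e
    empty∩rest (c∈e , c∈rest) | refl with ∈-++⁻ (startSpecial f r k) c∈rest
    ... | inj₁ c∈s with startSpecial-head f r k c∈s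
    ...   | _ , ()
    empty∩rest (c∈e , c∈rest) | refl | inj₂ c∈o with ∈-concatℕ⁻ r (startOrdinary f r k) c∈o
    ... | j , _ , c∈j with startOrdinary-head f r k j c∈j
    ...   | _ , () , _

  #Special : ℕ → ℕ → ℕ
  #Special r k = length (enum (suc (r + k)) r k)

  special-cardinality : ∀ r k → HasCardinality (Special r k) (#Special r k)
  special-cardinality r k = enum (suc (r + k)) r k , enum-unique (suc (r + k)) r k ,
    (λ c → mk⇔ (enum-sound (suc (r + k)) r k c) (enum-complete (suc (r + k)) r k c ℕP.≤-refl)) , refl

  countSpecialStart : ℕ → ℕ → ℤ
  countSpecialStart r zero    = + 0
  countSpecialStart r (suc k) = + #Special r k

  countOrdinaryStart : ℕ → ℕ → ℤ
  countOrdinaryStart r k = ∑ r (λ j → atLeast q j *ℤ + #Special (r ∸ suc j) k)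

  #Special-recurrence : ∀ r k →
    + #Special r k ≡ + length (startEmpty r k) +ℤ (countSpecialStart r k +ℤ countOrdinaryStart r k)
  #Special-recurrence r k = begin
    + length (startEmpty r k ++ (startSpecial (r + k) r k ++ concatℕ r (startOrdinary (r + k) r k)))
      ≡⟨ +length-++ (startEmpty r k) _ ⟩
    + length (startEmpty r k) +ℤ + length (startSpecial (r + k) r k ++ concatℕ r (startOrdinary (r + k) r k))
      ≡⟨ cong (+ length (startEmpty r k) +ℤ_) (trans (+length-++ (startSpecial (r + k) r k) _)
           (cong₂ _+ℤ_ (special k) (trans (length-concatℕ r (startOrdinary (r + k) r k)) (∑-cong r ordinary)))) ⟩
    + length (startEmpty r k) +ℤ (countSpecialStart r k +ℤ countOrdinaryStart r k) ∎
    where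
    open ≡-Reasoning
    +length-++ : ∀ (xs ys : List (List ℕ)) → + length (xs ++ ys) ≡ + length xs +ℤ + length ys
    +length-++ xs ys = trans (cong +_ (ListP.length-++ xs)) (ℤP.pos-+ (length xs) (length ys))
    special : ∀ k → + length (startSpecial (r + k) r k) ≡ countSpecialStart r k
    special zero    = refl
    special (suc k) = cong +_ (trans (ListP.length-map (q ∷_) (enum (r + suc k) r k))
      (cong (λ f → length (enum f r k)) (ℕP.+-suc r k)))
    ordinary : ∀ j → j < r →
      + length (startOrdinary (r + k) r k j) ≡ atLeast q j *ℤ + #Special (r ∸ suc j) k
    ordinary j j<r with ⌊ q ≤? j ⌋
    ... | true  = trans (cong +_ (trans (ListP.length-map (suc j ∷_) (enum (r + k) (r ∸ suc j) k))
                    (cong length (enum-fuel (r + k) (suc ((r ∸ suc j) + k)) (r ∸ suc j) k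
                      (remainder-smaller k j<r) ℕP.≤-refl))))
                    (sym (ℤP.*-identityˡ _))
    ... | false = refl

sgn-+ : ∀ a b → sgn (a + b) ≡ sgn a *ℤ sgn b
sgn-+ zero    b = sym (ℤP.*-identityˡ (sgn b))
sgn-+ (suc a) b = trans (cong -_ (sgn-+ a b)) (ℤP.neg-distribˡ-* (sgn a) (sgn b))

sgn-*-sgn : ∀ r a → sgn r *ℤ (sgn r *ℤ a) ≡ a
sgn-*-sgn zero    a = trans (ℤP.*-identityˡ _) (ℤP.*-identityˡ a)
sgn-*-sgn (suc r) a = begin
  - s *ℤ (- s *ℤ a)      ≡⟨ ℤP.neg-distribˡ-* s (- s *ℤ a) ⟨
  - (s *ℤ (- s *ℤ a))    ≡⟨ cong (λ t → - (s *ℤ t)) (ℤP.neg-distribˡ-* s a) ⟨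
  - (s *ℤ - (s *ℤ a))    ≡⟨ cong -_ (ℤP.neg-distribʳ-* s (s *ℤ a)) ⟨
  - - (s *ℤ (s *ℤ a))    ≡⟨ ℤP.neg-involutive _ ⟩
  s *ℤ (s *ℤ a)          ≡⟨ sgn-*-sgn r a ⟩
  a                      ∎
  where
  open ≡-Reasoning
  s = sgn r

sgn-cancel : ∀ r {a b} → sgn r *ℤ a ≡ sgn r *ℤ b → a ≡ b
sgn-cancel r {a} {b} e = trans (sym (sgn-*-sgn r a)) (trans (cong (sgn r *ℤ_) e) (sgn-*-sgn r b))

module CoefficientFormula (q : ℕ) where

  open CharacteristicPolynomial q
  open Compositions q

  VanishesAbove : ℕ → Set
  VanishesAbove n = ∀ k → n < k → d n k ≡ + 0

  SignedCount : ℕ → Set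
  SignedCount n = ∀ r k → r + k ≡ n → d n k ≡ sgn r *ℤ + #Special r k

  Formula : ℕ → Set
  Formula n = VanishesAbove n × SignedCount n

  term-vanishes : ∀ m k j → d (m ∸ j) k ≡ + 0 → term m k j ≡ + 0
  term-vanishes m k j e = trans (cong (λ x → sgn j *ℤ (- atLeast q j *ℤ x)) e)
    (trans (cong (sgn j *ℤ_) (ℤP.*-zeroʳ (- atLeast q j))) (ℤP.*-zeroʳ (sgn j)))

  module Step (m : ℕ) (ih : ∀ m′ → m′ ≤ m → Formula m′) where

    -- The sum in the coefficient recurrence is (−1)^r times the number of
    -- special compositions with an ordinary first part: the terms j < r
    -- match by the signed count for size m − j, the terms j ≥ r vanish.
    ∑-term : ∀ r k → r + k ≡ suc m → ∑ (suc m) (term m k) ≡ sgn r *ℤ countOrdinaryStart r k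
    ∑-term r k r+k≡ = begin
      ∑ (suc m) (term m k)
        ≡⟨ cong (λ n → ∑ n (term m k)) (sym r+k≡) ⟩
      ∑ (r + k) (term m k)
        ≡⟨ ∑-split r k (term m k) ⟩
      ∑ r (term m k) +ℤ ∑ k (λ j → term m k (r + j))
        ≡⟨ cong₂ _+ℤ_ (∑-cong r early) (∑-zero k late) ⟩
      ∑ r (λ j → sgn r *ℤ (atLeast q j *ℤ + #Special (r ∸ suc j) k)) +ℤ + 0
        ≡⟨ ℤP.+-identityʳ _ ⟩
      ∑ r (λ j → sgn r *ℤ (atLeast q j *ℤ + #Special (r ∸ suc j) k))
        ≡⟨ ∑-*ˡ r (sgn r) _ ⟩
      sgn r *ℤ countOrdinaryStart r k ∎
      where
      open ≡-Reasoning
      early : ∀ j → j < r → term m k j ≡ sgn r *ℤ (atLeast q j *ℤ + #Special (r ∸ suc j) k)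
      early j j<r = begin
        sgn j *ℤ (- atLeast q j *ℤ d (m ∸ j) k)
          ≡⟨ cong (λ x → sgn j *ℤ (- atLeast q j *ℤ x)) (proj₂ (ih (m ∸ j) (ℕP.m∸n≤m m j)) r′ k m∸j≡) ⟩
        sgn j *ℤ (- atLeast q j *ℤ (sgn r′ *ℤ + #Special r′ k))
          ≡⟨ solve 4 (λ s f t x → s :* (:- f :* (t :* x)) := (:- (s :* t)) :* (f :* x))
                   refl (sgn j) (atLeast q j) (sgn r′) (+ #Special r′ k) ⟩
        - (sgn j *ℤ sgn r′) *ℤ (atLeast q j *ℤ + #Special r′ k)
          ≡⟨ cong (_*ℤ (atLeast q j *ℤ + #Special r′ k)) sgn-r ⟨
        sgn r *ℤ (atLeast q j *ℤ + #Special r′ k) ∎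
        where
        open ℤSolver.+-*-Solver
        r′ = r ∸ suc j
        r≡ : suc j + r′ ≡ r
        r≡ = ℕP.m+[n∸m]≡n j<r
        m∸j≡ : r′ + k ≡ m ∸ j
        m∸j≡ = sym (trans (cong (_∸ j) m≡) (ℕP.m+n∸m≡n j (r′ + k)))
          where
          m≡ : m ≡ j + (r′ + k)
          m≡ = ℕP.suc-injective (trans (sym r+k≡) (trans (cong (_+ k) (sym r≡))
                 (cong suc (ℕP.+-assoc j r′ k))))
        sgn-r : sgn r ≡ - (sgn j *ℤ sgn r′)
        sgn-r = trans (cong sgn (sym r≡)) (cong -_ (sgn-+ j r′))
      late : ∀ j → j < k → term m k (r + j) ≡ + 0
      late j j<k = term-vanishes m k (r + j)
        (proj₁ (ih (m ∸ (r + j)) (ℕP.m∸n≤m m (r + j))) k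
          (ℕP.≤-<-trans (ℕP.∸-monoʳ-≤ m (ℕP.m≤m+n r j))
            (ℕP.m<n+o⇒m∸n<o m r {{>-nonZero (ℕP.≤-<-trans z≤n j<k)}} (ℕP.≤-reflexive (sym r+k≡)))))

    vanishesAbove : VanishesAbove (suc m)
    vanishesAbove (suc k) (s≤s m<k) = begin
      d (suc m) (suc k)                      ≡⟨ d-recurrence-suc m k ⟩
      d m k +ℤ ∑ (suc m) (term m (suc k))    ≡⟨ cong₂ _+ℤ_ (proj₁ (ih m ℕP.≤-refl) k m<k) (∑-zero (suc m) lower) ⟩
      + 0                                     ∎
      where
      open ≡-Reasoning
      lower : ∀ j → j < suc m → term m (suc k) j ≡ + 0
      lower j _ = term-vanishes m (suc k) j (proj₁ (ih (m ∸ j) (ℕP.m∸n≤m m j)) (suc k)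
        (ℕP.≤-trans (s≤s (ℕP.m∸n≤m m j)) (ℕP.m≤n⇒m≤1+n m<k)))

    signedCount : SignedCount (suc m)
    signedCount (suc r) zero e = begin
      d (suc m) 0                                      ≡⟨ d-recurrence-zero m ⟩
      ∑ (suc m) (term m 0)                             ≡⟨ ∑-term (suc r) 0 e ⟩
      sgn (suc r) *ℤ countOrdinaryStart (suc r) 0      ≡⟨ cong (sgn (suc r) *ℤ_) count≡ ⟨
      sgn (suc r) *ℤ + #Special (suc r) 0              ∎
      where
      open ≡-Reasoning
      count≡ : + #Special (suc r) 0 ≡ countOrdinaryStart (suc r) 0
      count≡ = trans (#Special-recurrence (suc r) 0) (trans (ℤP.+-identityˡ _) (ℤP.+-identityˡ _))
    signedCount r (suc k) e = begin
      d (suc m) (suc k)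
        ≡⟨ d-recurrence-suc m k ⟩
      d m k +ℤ ∑ (suc m) (term m (suc k))
        ≡⟨ cong₂ _+ℤ_ (proj₂ (ih m ℕP.≤-refl) r k r+k≡m) (∑-term r (suc k) e) ⟩
      sgn r *ℤ + #Special r k +ℤ sgn r *ℤ countOrdinaryStart r (suc k)
        ≡⟨ ℤP.*-distribˡ-+ (sgn r) _ _ ⟨
      sgn r *ℤ (+ #Special r k +ℤ countOrdinaryStart r (suc k))
        ≡⟨ cong (sgn r *ℤ_) (trans (#Special-recurrence r (suc k)) (ℤP.+-identityˡ _)) ⟨
      sgn r *ℤ + #Special r (suc k) ∎
      where
      open ≡-Reasoning
      r+k≡m : r + k ≡ m
      r+k≡m = ℕP.suc-injective (trans (sym (ℕP.+-suc r k)) e)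

  coefficient-formula : ∀ n → Formula n
  coefficient-formula = <-rec Formula step
    where
    step : ∀ n → (∀ {m} → m < n → Formula m) → Formula n
    step zero    _  = (λ { (suc k) _ → refl }) , λ { zero zero _ → refl ; zero (suc k) () ; (suc r) k () }
    step (suc m) ih = Step.vanishesAbove m below , Step.signedCount m below
      where
      below : ∀ m′ → m′ ≤ m → Formula m′
      below m′ m′≤m = ih (s≤s m′≤m)

-- The size of the compositions in the theorem: with n = r + k and p = q + 1,
-- n + kp − 2k = r + kq.
composition-size : ∀ r k q → (r + k) + k * suc q ∸ 2 * k ≡ r + k * q
composition-size r k q = trans (cong (_∸ 2 * k) rearrange) (ℕP.m+n∸n≡m (r + k * q) (2 * k))
  where
  open ℕSolver.+-*-Solver
  rearrange : (r + k) + k * suc q ≡ (r + k * q) + 2 * k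
  rearrange = solve 3 (λ r k q → (r :+ k) :+ k :* (con 1 :+ q) := (r :+ k :* q) :+ con 2 :* k) refl r k q

corollary4 : (n p k : ℕ) → .{{_ : NonZero n}} → .{{_ : NonZero p}} → k ≤ n →
    (a : ℤ) → coeff (charPoly (F n p)) k ≡ sgn (n ∸ k) Data.Integer.* a →
    Σ ℕ λ N → HasCardinality (IsSpecialComposition (n + k * p ∸ 2 * k) k p) N × a ≡ + N
corollary4 n (suc q) k k≤n a coeff≡ =
  #Special r k ,
  subst (λ m → HasCardinality (IsSpecialComposition m k (suc q)) (#Special r k)) size≡ (special-cardinality r k) ,
  sgn-cancel r (begin
    sgn r *ℤ a                        ≡⟨ coeff≡ ⟨
    coeff (charPoly (F n (suc q))) k  ≡⟨ cong (λ P → coeff P k) (charPoly≡D n) ⟩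
    d n k                             ≡⟨ proj₂ (coefficient-formula n) r k r+k≡n ⟩
    sgn r *ℤ + #Special r k           ∎)
  where
  open ≡-Reasoning
  open CharacteristicPolynomial q
  open Compositions q
  open CoefficientFormula q
  r = n ∸ k
  r+k≡n : r + k ≡ n
  r+k≡n = ℕP.m∸n+n≡m k≤n
  size≡ : r + k * q ≡ n + k * suc q ∸ 2 * k
  size≡ = trans (sym (composition-size r k q)) (cong (λ n → n + k * suc q ∸ 2 * k) r+k≡n)
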